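{- For every integer $p\ge1$, all integers $0\le k\le n$ and real $x$, \[ \sum_{j=0}^{n-k}\binom{n-k}{j}B_{j+k}^{(p)}(x)=\sum_{j=0}^{k}\binom{k}{j}(-1)^{j}\left\{B_{n-j}^{(p)}(x)+(n-j)B_{n-j-1}^{(p-1)}(x)\right\}, \] where the term $(n-j)B_{n-j-1}^{(p-1)}(x)$ is interpreted as $0$ when $n-j=0$.
   Context: For an integer $p\ge0$, the higher-order Bernoulli polynomials $B_n^{(p)}(x)$ are defined by $\sum_{n\ge0}B_n^{(p)}(x)\frac{t^n}{n!}=e^{xt}\left(\frac{t}{e^t-1}\right)^p$; in particular $B_n^{(0)}(x)=x^n$.
   Formalization: The variable x ranges over the rationals rather than over all real numbers. -}

module Defs where

open import Data.Nat using (ℕ; zero; suc; _∸_; _≤?_)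
open import Data.Nat.Combinatorics using (_C_)
open import Data.Integer using (+_)
open import Data.Rational using (ℚ; _+_; _*_; -_; _/_; 0ℚ; 1ℚ)
open import Relation.Nullary using (yes; no)

ℕ→ℚ : ℕ → ℚ
ℕ→ℚ n = (+ n) / 1

_^ℚ_ : ℚ → ℕ → ℚ
x ^ℚ zero  = 1ℚ
x ^ℚ suc n = x * (x ^ℚ n)

sgn : ℕ → ℚ
sgn j = (- 1ℚ) ^ℚ j

sumTo : ℕ → (ℕ → ℚ) → ℚ
sumTo zero    f = f 0
sumTo (suc n) f = sumTo n f + f (suc n)

binom : ℕ → ℕ → ℚ
binom n k = ℕ→ℚ (n C k)

-- Product of exponential generating functions:
-- (Σ a_n t^n/n!)(Σ b_n t^n/n!) = Σ (a ⊛ b)_n t^n/n!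
_⊛_ : (ℕ → ℚ) → (ℕ → ℚ) → (ℕ → ℚ)
(a ⊛ b) n = sumTo n (λ k → binom n k * (a k * b (n ∸ k)))

-- Bernoulli numbers b_n : the EGF coefficients of t/(e^t - 1), defined as the
-- EGF-inverse of (e^t - 1)/t = Σ t^n/(n+1)!, whose EGF coefficients are 1/(n+1).
-- So b_0 = 1 and for m ≥ 1:  b_m = - Σ_{k<m} C(m,k) b_k / (m - k + 1).
-- bernPrefix n k = b_k for all k ≤ n.
bernPrefix : ℕ → ℕ → ℚ
bernPrefix zero    k = 1ℚ
bernPrefix (suc n) k with k ≤? n
... | yes _ = bernPrefix n k
... | no  _ = - sumTo n (λ i → binom (suc n) i * (bernPrefix n i * ((+ 1) / suc (suc n ∸ i))))

bern : ℕ → ℚ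
bern n = bernPrefix n n

-- Higher-order Bernoulli polynomials B_n^{(p)}(x):
-- EGF e^{xt} (t/(e^t-1))^p, so B^{(0)}_n(x) = x^n and B^{(p+1)} = B^{(p)} ⊛ b.
B : ℕ → ℚ → ℕ → ℚ
B zero    x n = x ^ℚ n
B (suc p) x   = B p x ⊛ bern

corr : ℕ → ℚ → ℕ → ℚ
corr q x zero    = 0ℚ
corr q x (suc m) = ℕ→ℚ (suc m) * B q x m

-- Write a for the coefficient sequence of B^{(p)}(x) and h_N = Σ_j C(N,j) a_j for its binomial
-- transform, whose EGF is e^t times that of a.  Since (t/(e^t-1))·e^t = t/(e^t-1) + t, the series
-- e^{xt}(t/(e^t-1))^p e^t equals e^{xt}(t/(e^t-1))^p + t·e^{xt}(t/(e^t-1))^{p-1}, i.e.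
-- h_N = B^{(p)}_N(x) + N B^{(p-1)}_{N-1}(x).  The theorem is then binomial inversion
-- between a and h.
module Submission where

open import Data.Nat using (ℕ; zero; suc; _≤_; _∸_; _+_; z≤n; s≤s; _≤?_)
open import Data.Nat.Properties
  using (≤-refl; m≤n⇒m≤1+n; m≤n+m; n<1+n; <-irrefl; +-∸-assoc; m∸n+n≡m; n∸n≡0; +-suc)
  renaming (+-identityʳ to +-identityʳ-ℕ)
open import Data.Nat.Combinatorics using (_C_; nCk+nC[k+1]≡[n+1]C[k+1]; k>n⇒nCk≡0; nCn≡1)
open import Data.Nat.Coprimality using (1-coprimeTo)
import Data.Nat.Coprimality as Coprimality
open import Data.Integer using (+_)
import Data.Integer as ℤ
import Data.Integer.Properties as ℤ
open import Data.Rational using (ℚ; mkℚ; 0ℚ; 1ℚ; -_; _/_) renaming (_+_ to _+ℚ_; _*_ to _*ℚ_)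
open import Data.Rational.Properties
  using (normalize-coprime; *-inverseʳ; *-identityʳ; *-distribˡ-+; *-distribʳ-+; +-assoc; +-comm; +-identityˡ; +-identityʳ)
open import Data.Rational.Solver using (module +-*-Solver)
open import Data.Empty using (⊥-elim)
open import Function using (const)
open import Relation.Binary.PropositionalEquality using (_≡_; _≗_; refl; sym; trans; cong; cong₂; subst; module ≡-Reasoning)
open import Relation.Nullary using (yes; no)

open import Defs

open +-*-Solver
open ≡-Reasoning

sumTo-cong : ∀ n {f g : ℕ → ℚ} → (∀ j → j ≤ n → f j ≡ g j) → sumTo n f ≡ sumTo n g
sumTo-cong zero    f≡g = f≡g 0 z≤n
sumTo-cong (suc n) f≡g =
  cong₂ _+ℚ_ (sumTo-cong n (λ j j≤n → f≡g j (m≤n⇒m≤1+n j≤n))) (f≡g (suc n) ≤-refl)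

sumTo-+ : ∀ n (f g : ℕ → ℚ) → sumTo n (λ j → f j +ℚ g j) ≡ sumTo n f +ℚ sumTo n g
sumTo-+ zero    f g = refl
sumTo-+ (suc n) f g = begin
  sumTo n (λ j → f j +ℚ g j) +ℚ (f (suc n) +ℚ g (suc n))
    ≡⟨ cong (_+ℚ (f (suc n) +ℚ g (suc n))) (sumTo-+ n f g) ⟩
  (sumTo n f +ℚ sumTo n g) +ℚ (f (suc n) +ℚ g (suc n))
    ≡⟨ solve 4 (λ a b c d → (a :+ b) :+ (c :+ d) := (a :+ c) :+ (b :+ d)) refl
         (sumTo n f) (sumTo n g) (f (suc n)) (g (suc n)) ⟩
  sumTo (suc n) f +ℚ sumTo (suc n) g ∎

*-distribˡ-sumTo : ∀ n c (f : ℕ → ℚ) → c *ℚ sumTo n f ≡ sumTo n (λ j → c *ℚ f j)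
*-distribˡ-sumTo zero    c f = refl
*-distribˡ-sumTo (suc n) c f =
  trans (*-distribˡ-+ c (sumTo n f) (f (suc n))) (cong (_+ℚ c *ℚ f (suc n)) (*-distribˡ-sumTo n c f))

sumTo-suc-head : ∀ n (f : ℕ → ℚ) → sumTo (suc n) f ≡ f 0 +ℚ sumTo n (λ j → f (suc j))
sumTo-suc-head zero    f = refl
sumTo-suc-head (suc n) f = trans (cong (_+ℚ f (suc (suc n))) (sumTo-suc-head n f)) (+-assoc (f 0) _ _)

sumTo-const-0 : ∀ n → sumTo n (const 0ℚ) ≡ 0ℚ
sumTo-const-0 zero    = refl
sumTo-const-0 (suc n) = cong (_+ℚ 0ℚ) (sumTo-const-0 n)

ℕ→ℚ≡mkℚ : ∀ n → ℕ→ℚ n ≡ mkℚ (+ n) 0 (Coprimality.sym (1-coprimeTo n))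
ℕ→ℚ≡mkℚ n = normalize-coprime (Coprimality.sym (1-coprimeTo n))

ℕ→ℚ-+ : ∀ m n → ℕ→ℚ (m + n) ≡ ℕ→ℚ m +ℚ ℕ→ℚ n
ℕ→ℚ-+ m n rewrite ℕ→ℚ≡mkℚ m | ℕ→ℚ≡mkℚ n =
  cong (_/ 1) (sym (trans (cong₂ ℤ._+_ (ℤ.*-identityʳ (+ m)) (ℤ.*-identityʳ (+ n))) (ℤ.pos-+ m n)))

ℕ→ℚ-*-reciprocal : ∀ n → ℕ→ℚ (suc n) *ℚ (+ 1 / suc n) ≡ 1ℚ
ℕ→ℚ-*-reciprocal n rewrite ℕ→ℚ≡mkℚ (suc n) | normalize-coprime {1} {n} (1-coprimeTo (suc n)) =
  *-inverseʳ (mkℚ (+ suc n) 0 (Coprimality.sym (1-coprimeTo (suc n))))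

binom-pascal : ∀ m j → binom (suc m) (suc j) ≡ binom m j +ℚ binom m (suc j)
binom-pascal m j =
  trans (cong ℕ→ℚ (sym (nCk+nC[k+1]≡[n+1]C[k+1] m j))) (ℕ→ℚ-+ (m C j) (m C suc j))

binom-suc-diagonal : ∀ m → binom m (suc m) ≡ 0ℚ
binom-suc-diagonal m = cong ℕ→ℚ (k>n⇒nCk≡0 (n<1+n m))

Seq : Set
Seq = ℕ → ℚ

shift : Seq → Seq
shift a n = a (suc n)

_⊕_ : Seq → Seq → Seq
(a ⊕ b) n = a n +ℚ b n

binomialSum : ℕ → Seq → ℚ
binomialSum m a = sumTo m (λ j → binom m j *ℚ a j)

binomialSum-suc : ∀ m (a : Seq) → binomialSum (suc m) a ≡ binomialSum m a +ℚ binomialSum m (shift a)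
binomialSum-suc m a = begin
  binomialSum (suc m) a
    ≡⟨ sumTo-suc-head m _ ⟩
  1ℚ *ℚ a 0 +ℚ sumTo m (λ j → binom (suc m) (suc j) *ℚ a (suc j))
    ≡⟨ cong (1ℚ *ℚ a 0 +ℚ_) (sumTo-cong m λ j _ → pascal-term j) ⟩
  1ℚ *ℚ a 0 +ℚ sumTo m (λ j → binom m j *ℚ a (suc j) +ℚ binom m (suc j) *ℚ a (suc j))
    ≡⟨ cong (1ℚ *ℚ a 0 +ℚ_) (sumTo-+ m _ _) ⟩
  1ℚ *ℚ a 0 +ℚ (binomialSum m (shift a) +ℚ upper)
    ≡⟨ solve 3 (λ u x y → u :+ (x :+ y) := (u :+ y) :+ x) refl (1ℚ *ℚ a 0) (binomialSum m (shift a)) upper ⟩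
  (1ℚ *ℚ a 0 +ℚ upper) +ℚ binomialSum m (shift a)
    ≡⟨ cong (_+ℚ binomialSum m (shift a)) (sym (sumTo-suc-head m (λ j → binom m j *ℚ a j))) ⟩
  (binomialSum m a +ℚ binom m (suc m) *ℚ a (suc m)) +ℚ binomialSum m (shift a)
    ≡⟨ cong (λ c → (binomialSum m a +ℚ c *ℚ a (suc m)) +ℚ binomialSum m (shift a)) (binom-suc-diagonal m) ⟩
  (binomialSum m a +ℚ 0ℚ *ℚ a (suc m)) +ℚ binomialSum m (shift a)
    ≡⟨ cong (_+ℚ binomialSum m (shift a)) (solve 2 (λ s b → s :+ con 0ℚ :* b := s) refl (binomialSum m a) (a (suc m))) ⟩
  binomialSum m a +ℚ binomialSum m (shift a) ∎
  where
  upper = sumTo m (λ j → binom m (suc j) *ℚ a (suc j))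
  pascal-term : ∀ j → binom (suc m) (suc j) *ℚ a (suc j) ≡ binom m j *ℚ a (suc j) +ℚ binom m (suc j) *ℚ a (suc j)
  pascal-term j = trans (cong (_*ℚ a (suc j)) (binom-pascal m j)) (*-distribʳ-+ (a (suc j)) (binom m j) (binom m (suc j)))

-- E^k = ((E + 1) - 1)^k for the shift E, since binomialSum m a is (E + 1)^m a at 0.
binomialSum-shift-inversion : ∀ (f : Seq) k m →
  binomialSum m (λ j → f (j + k)) ≡ binomialSum k (λ j → sgn j *ℚ binomialSum (m + k ∸ j) f)
binomialSum-shift-inversion f zero m = begin
  binomialSum m (λ j → f (j + 0))  ≡⟨ sumTo-cong m (λ j _ → cong (λ i → binom m j *ℚ f i) (+-identityʳ-ℕ j)) ⟩
  binomialSum m f                  ≡⟨ cong (λ i → binomialSum i f) (sym (+-identityʳ-ℕ m)) ⟩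
  binomialSum (m + 0) f            ≡⟨ solve 1 (λ y → y := con 1ℚ :* (con 1ℚ :* y)) refl (binomialSum (m + 0) f) ⟩
  binomialSum 0 (λ j → sgn j *ℚ binomialSum (m + 0 ∸ j) f) ∎
binomialSum-shift-inversion f (suc k) m = begin
  binomialSum m (λ j → f (j + suc k))
    ≡⟨ sumTo-cong m (λ j _ → cong (λ i → binom m j *ℚ f i) (+-suc j k)) ⟩
  binomialSum m (shift F)
    ≡⟨ solve 2 (λ b x → x := (b :+ x) :+ (:- con 1ℚ) :* b) refl (binomialSum m F) (binomialSum m (shift F)) ⟩
  (binomialSum m F +ℚ binomialSum m (shift F)) +ℚ (- 1ℚ) *ℚ binomialSum m F
    ≡⟨ cong (_+ℚ (- 1ℚ) *ℚ binomialSum m F) (sym (binomialSum-suc m F)) ⟩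
  binomialSum (suc m) F +ℚ (- 1ℚ) *ℚ binomialSum m F
    ≡⟨ cong₂ (λ u v → u +ℚ (- 1ℚ) *ℚ v) (binomialSum-shift-inversion f k (suc m)) (binomialSum-shift-inversion f k m) ⟩
  binomialSum k (λ j → sgn j *ℚ binomialSum (suc m + k ∸ j) f)
    +ℚ (- 1ℚ) *ℚ binomialSum k (λ j → sgn j *ℚ binomialSum (m + k ∸ j) f)
    ≡⟨ cong₂ _+ℚ_ (sumTo-cong k λ j _ → cong (λ i → binom k j *ℚ (sgn j *ℚ binomialSum (i ∸ j) f)) (sym (+-suc m k)))
                  (trans (*-distribˡ-sumTo k (- 1ℚ) _) (sumTo-cong k λ j _ → negated-term j)) ⟩
  binomialSum k G +ℚ binomialSum k (shift G)
    ≡⟨ sym (binomialSum-suc k G) ⟩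
  binomialSum (suc k) G ∎
  where
  F = λ j → f (j + k)
  G = λ j → sgn j *ℚ binomialSum (m + suc k ∸ j) f
  negated-term : ∀ j → (- 1ℚ) *ℚ (binom k j *ℚ (sgn j *ℚ binomialSum (m + k ∸ j) f)) ≡ binom k j *ℚ shift G j
  negated-term j = begin
    (- 1ℚ) *ℚ (binom k j *ℚ (sgn j *ℚ binomialSum (m + k ∸ j) f))
      ≡⟨ cong (λ i → (- 1ℚ) *ℚ (binom k j *ℚ (sgn j *ℚ binomialSum (i ∸ suc j) f))) (sym (+-suc m k)) ⟩
    (- 1ℚ) *ℚ (binom k j *ℚ (sgn j *ℚ binomialSum (m + suc k ∸ suc j) f))
      ≡⟨ solve 4 (λ c b s y → c :* (b :* (s :* y)) := b :* ((c :* s) :* y)) refl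
           (- 1ℚ) (binom k j) (sgn j) (binomialSum (m + suc k ∸ suc j) f) ⟩
    binom k j *ℚ shift G j ∎

shift-⊛ : ∀ (a b : Seq) → shift (a ⊛ b) ≗ (shift a ⊛ b) ⊕ (a ⊛ shift b)
shift-⊛ a b n = begin
  (a ⊛ b) (suc n)
    ≡⟨ binomialSum-suc n g ⟩
  binomialSum n g +ℚ (shift a ⊛ b) n
    ≡⟨ cong (_+ℚ (shift a ⊛ b) n) (sumTo-cong n λ j j≤n → cong (λ i → binom n j *ℚ (a j *ℚ b i)) (+-∸-assoc 1 j≤n)) ⟩
  (a ⊛ shift b) n +ℚ (shift a ⊛ b) n
    ≡⟨ +-comm ((a ⊛ shift b) n) ((shift a ⊛ b) n) ⟩
  (shift a ⊛ b) n +ℚ (a ⊛ shift b) n ∎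
  where g = λ j → a j *ℚ b (suc n ∸ j)

⊛-congˡ : ∀ {a a′ : Seq} → a ≗ a′ → ∀ b → a ⊛ b ≗ a′ ⊛ b
⊛-congˡ a≗a′ b n = sumTo-cong n λ j _ → cong (λ u → binom n j *ℚ (u *ℚ b (n ∸ j))) (a≗a′ j)

⊛-congʳ : ∀ a {b b′ : Seq} → b ≗ b′ → a ⊛ b ≗ a ⊛ b′
⊛-congʳ a b≗b′ n = sumTo-cong n λ j _ → cong (λ v → binom n j *ℚ (a j *ℚ v)) (b≗b′ (n ∸ j))

⊛-distribˡ-⊕ : ∀ (a b c : Seq) → a ⊛ (b ⊕ c) ≗ (a ⊛ b) ⊕ (a ⊛ c)
⊛-distribˡ-⊕ a b c n = trans
  (sumTo-cong n λ j _ → solve 4 (λ k x y z → k :* (x :* (y :+ z)) := k :* (x :* y) :+ k :* (x :* z)) refl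
                          (binom n j) (a j) (b (n ∸ j)) (c (n ∸ j)))
  (sumTo-+ n _ _)

⊛-distribʳ-⊕ : ∀ (a b c : Seq) → (a ⊕ b) ⊛ c ≗ (a ⊛ c) ⊕ (b ⊛ c)
⊛-distribʳ-⊕ a b c n = trans
  (sumTo-cong n λ j _ → solve 4 (λ k x y z → k :* ((x :+ y) :* z) := k :* (x :* z) :+ k :* (y :* z)) refl
                          (binom n j) (a j) (b j) (c (n ∸ j)))
  (sumTo-+ n _ _)

⊛-assoc : ∀ (a b c : Seq) → (a ⊛ b) ⊛ c ≗ a ⊛ (b ⊛ c)
⊛-assoc a b c zero =
  solve 3 (λ x y z → con 1ℚ :* ((con 1ℚ :* (x :* y)) :* z) := con 1ℚ :* (x :* (con 1ℚ :* (y :* z)))) refl (a 0) (b 0) (c 0)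
⊛-assoc a b c (suc n) = begin
  ((a ⊛ b) ⊛ c) (suc n)
    ≡⟨ shift-⊛ (a ⊛ b) c n ⟩
  (shift (a ⊛ b) ⊛ c) n +ℚ ((a ⊛ b) ⊛ shift c) n
    ≡⟨ cong (_+ℚ ((a ⊛ b) ⊛ shift c) n) (trans (⊛-congˡ (shift-⊛ a b) c n) (⊛-distribʳ-⊕ (shift a ⊛ b) (a ⊛ shift b) c n)) ⟩
  (((shift a ⊛ b) ⊛ c) n +ℚ ((a ⊛ shift b) ⊛ c) n) +ℚ ((a ⊛ b) ⊛ shift c) n
    ≡⟨ cong₂ _+ℚ_ (cong₂ _+ℚ_ (⊛-assoc (shift a) b c n) (⊛-assoc a (shift b) c n)) (⊛-assoc a b (shift c) n) ⟩
  ((shift a ⊛ (b ⊛ c)) n +ℚ (a ⊛ (shift b ⊛ c)) n) +ℚ (a ⊛ (b ⊛ shift c)) n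
    ≡⟨ +-assoc ((shift a ⊛ (b ⊛ c)) n) _ _ ⟩
  (shift a ⊛ (b ⊛ c)) n +ℚ ((a ⊛ (shift b ⊛ c)) n +ℚ (a ⊛ (b ⊛ shift c)) n)
    ≡⟨ cong ((shift a ⊛ (b ⊛ c)) n +ℚ_) (sym (trans (⊛-congʳ a (shift-⊛ b c) n) (⊛-distribˡ-⊕ a (shift b ⊛ c) (b ⊛ shift c) n))) ⟩
  (shift a ⊛ (b ⊛ c)) n +ℚ (a ⊛ shift (b ⊛ c)) n
    ≡⟨ sym (shift-⊛ a (b ⊛ c) n) ⟩
  (a ⊛ (b ⊛ c)) (suc n) ∎

one : Seq
one zero    = 1ℚ
one (suc _) = 0ℚ

⊛-zeroʳ : ∀ (a : Seq) → a ⊛ const 0ℚ ≗ const 0ℚ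
⊛-zeroʳ a n = trans (sumTo-cong n λ j _ → solve 2 (λ k x → k :* (x :* con 0ℚ) := con 0ℚ) refl (binom n j) (a j))
                    (sumTo-const-0 n)

⊛-identityʳ : ∀ (a : Seq) → a ⊛ one ≗ a
⊛-identityʳ a zero    = solve 1 (λ x → con 1ℚ :* (x :* con 1ℚ) := x) refl (a 0)
⊛-identityʳ a (suc n) = begin
  (a ⊛ one) (suc n)                             ≡⟨ shift-⊛ a one n ⟩
  (shift a ⊛ one) n +ℚ (a ⊛ const 0ℚ) n         ≡⟨ cong₂ _+ℚ_ (⊛-identityʳ (shift a) n) (⊛-zeroʳ a n) ⟩
  a (suc n) +ℚ 0ℚ                               ≡⟨ +-identityʳ (a (suc n)) ⟩
  a (suc n) ∎

-- EGF coefficients of t·A(t), for a those of A(t).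
times-t : Seq → Seq
times-t a zero    = 0ℚ
times-t a (suc n) = ℕ→ℚ (suc n) *ℚ a n

times-t-cong : ∀ {a b : Seq} → a ≗ b → times-t a ≗ times-t b
times-t-cong a≗b zero    = refl
times-t-cong a≗b (suc n) = cong (ℕ→ℚ (suc n) *ℚ_) (a≗b n)

times-t-⊕ : ∀ (a b : Seq) → times-t (a ⊕ b) ≗ times-t a ⊕ times-t b
times-t-⊕ a b zero    = refl
times-t-⊕ a b (suc n) = *-distribˡ-+ (ℕ→ℚ (suc n)) (a n) (b n)

times-t-suc : ∀ (a : Seq) n → times-t a (suc n) ≡ times-t (shift a) n +ℚ a n
times-t-suc a zero    = solve 1 (λ x → con 1ℚ :* x := con 0ℚ :+ x) refl (a 0)
times-t-suc a (suc n) = begin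
  ℕ→ℚ (suc (suc n)) *ℚ a (suc n)          ≡⟨ cong (_*ℚ a (suc n)) (ℕ→ℚ-+ 1 (suc n)) ⟩
  (1ℚ +ℚ ℕ→ℚ (suc n)) *ℚ a (suc n)        ≡⟨ solve 2 (λ k x → (con 1ℚ :+ k) :* x := k :* x :+ x) refl (ℕ→ℚ (suc n)) (a (suc n)) ⟩
  ℕ→ℚ (suc n) *ℚ a (suc n) +ℚ a (suc n) ∎

shift-times-t : ∀ (a : Seq) → shift (times-t a) ≗ a ⊕ times-t (shift a)
shift-times-t a n = trans (times-t-suc a n) (+-comm (times-t (shift a) n) (a n))

⊛-times-t : ∀ (a c : Seq) → a ⊛ times-t c ≗ times-t (a ⊛ c)
⊛-times-t a c zero    = solve 2 (λ x y → con 1ℚ :* (x :* con 0ℚ) := con 0ℚ) refl (a 0) (c 0)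
⊛-times-t a c (suc n) = begin
  (a ⊛ times-t c) (suc n)
    ≡⟨ shift-⊛ a (times-t c) n ⟩
  (shift a ⊛ times-t c) n +ℚ (a ⊛ shift (times-t c)) n
    ≡⟨ cong₂ _+ℚ_ (⊛-times-t (shift a) c n) (trans (⊛-congʳ a (shift-times-t c) n) (⊛-distribˡ-⊕ a c (times-t (shift c)) n)) ⟩
  times-t (shift a ⊛ c) n +ℚ ((a ⊛ c) n +ℚ (a ⊛ times-t (shift c)) n)
    ≡⟨ cong (λ z → times-t (shift a ⊛ c) n +ℚ ((a ⊛ c) n +ℚ z)) (⊛-times-t a (shift c) n) ⟩
  times-t (shift a ⊛ c) n +ℚ ((a ⊛ c) n +ℚ times-t (a ⊛ shift c) n)
    ≡⟨ solve 3 (λ x y z → x :+ (y :+ z) := (x :+ z) :+ y) refl (times-t (shift a ⊛ c) n) ((a ⊛ c) n) (times-t (a ⊛ shift c) n) ⟩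
  (times-t (shift a ⊛ c) n +ℚ times-t (a ⊛ shift c) n) +ℚ (a ⊛ c) n
    ≡⟨ cong (_+ℚ (a ⊛ c) n) (sym (trans (times-t-cong (shift-⊛ a c) n) (times-t-⊕ (shift a ⊛ c) (a ⊛ shift c) n))) ⟩
  times-t (shift (a ⊛ c)) n +ℚ (a ⊛ c) n
    ≡⟨ sym (times-t-suc (a ⊛ c) n) ⟩
  times-t (a ⊛ c) (suc n) ∎

bernPrefix-+ : ∀ d i → bernPrefix (d + i) i ≡ bern i
bernPrefix-+ zero    i = refl
bernPrefix-+ (suc d) i with i ≤? d + i
... | yes _   = bernPrefix-+ d i
... | no  i≰ = ⊥-elim (i≰ (m≤n+m i d))

bernPrefix-≤ : ∀ {i m} → i ≤ m → bernPrefix m i ≡ bern i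
bernPrefix-≤ {i} {m} i≤m = subst (λ m → bernPrefix m i ≡ bern i) (m∸n+n≡m i≤m) (bernPrefix-+ (m ∸ i) i)

expm1/t : Seq
expm1/t j = + 1 / suc j

exp : Seq
exp = const 1ℚ

bern-suc : ∀ m → bern (suc m) ≡ - sumTo m (λ i → binom (suc m) i *ℚ (bernPrefix m i *ℚ expm1/t (suc m ∸ i)))
bern-suc m with suc m ≤? m
... | yes m<m = ⊥-elim (<-irrefl refl m<m)
... | no  _   = refl

bern-⊛-expm1/t : bern ⊛ expm1/t ≗ one
bern-⊛-expm1/t zero    = refl
bern-⊛-expm1/t (suc m) = begin
  lower +ℚ binom (suc m) (suc m) *ℚ (bern (suc m) *ℚ expm1/t (m ∸ m))
    ≡⟨ cong₂ (λ c i → lower +ℚ c *ℚ (bern (suc m) *ℚ expm1/t i)) (cong ℕ→ℚ (nCn≡1 (suc m))) (n∸n≡0 m) ⟩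
  lower +ℚ 1ℚ *ℚ (bern (suc m) *ℚ 1ℚ)
    ≡⟨ cong (λ b → lower +ℚ 1ℚ *ℚ (b *ℚ 1ℚ)) (trans (bern-suc m) (cong -_ (sumTo-cong m λ i i≤m →
         cong (λ b → binom (suc m) i *ℚ (b *ℚ expm1/t (suc m ∸ i))) (bernPrefix-≤ i≤m)))) ⟩
  lower +ℚ 1ℚ *ℚ (- lower *ℚ 1ℚ)
    ≡⟨ solve 1 (λ x → x :+ con 1ℚ :* (:- x :* con 1ℚ) := con 0ℚ) refl lower ⟩
  0ℚ ∎
  where lower = sumTo m (λ i → binom (suc m) i *ℚ (bern i *ℚ expm1/t (suc m ∸ i)))

exp≗one⊕t·expm1/t : exp ≗ one ⊕ times-t expm1/t
exp≗one⊕t·expm1/t zero    = refl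
exp≗one⊕t·expm1/t (suc j) = sym (trans (+-identityˡ _) (ℕ→ℚ-*-reciprocal j))

bern-⊛-exp : bern ⊛ exp ≗ bern ⊕ times-t one
bern-⊛-exp n = begin
  (bern ⊛ exp) n                                  ≡⟨ ⊛-congʳ bern exp≗one⊕t·expm1/t n ⟩
  (bern ⊛ (one ⊕ times-t expm1/t)) n              ≡⟨ ⊛-distribˡ-⊕ bern one (times-t expm1/t) n ⟩
  (bern ⊛ one) n +ℚ (bern ⊛ times-t expm1/t) n    ≡⟨ cong₂ _+ℚ_ (⊛-identityʳ bern n) (⊛-times-t bern expm1/t n) ⟩
  bern n +ℚ times-t (bern ⊛ expm1/t) n            ≡⟨ cong (bern n +ℚ_) (times-t-cong bern-⊛-expm1/t n) ⟩
  bern n +ℚ times-t one n ∎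

binomialSum≡⊛-exp : ∀ N (a : Seq) → binomialSum N a ≡ (a ⊛ exp) N
binomialSum≡⊛-exp N a = sumTo-cong N λ j _ → cong (binom N j *ℚ_) (sym (*-identityʳ (a j)))

corr≡times-t : ∀ q x → corr q x ≗ times-t (B q x)
corr≡times-t q x zero    = refl
corr≡times-t q x (suc N) = refl

binomialSum-B : ∀ q x N → binomialSum N (B (suc q) x) ≡ B (suc q) x N +ℚ corr q x N
binomialSum-B q x N = begin
  binomialSum N (B q x ⊛ bern)                      ≡⟨ binomialSum≡⊛-exp N _ ⟩
  ((B q x ⊛ bern) ⊛ exp) N                          ≡⟨ ⊛-assoc (B q x) bern exp N ⟩
  (B q x ⊛ (bern ⊛ exp)) N                          ≡⟨ ⊛-congʳ (B q x) bern-⊛-exp N ⟩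
  (B q x ⊛ (bern ⊕ times-t one)) N                  ≡⟨ ⊛-distribˡ-⊕ (B q x) bern (times-t one) N ⟩
  (B q x ⊛ bern) N +ℚ (B q x ⊛ times-t one) N       ≡⟨ cong ((B q x ⊛ bern) N +ℚ_) (⊛-times-t (B q x) one N) ⟩
  (B q x ⊛ bern) N +ℚ times-t (B q x ⊛ one) N       ≡⟨ cong ((B q x ⊛ bern) N +ℚ_) (times-t-cong (⊛-identityʳ (B q x)) N) ⟩
  (B q x ⊛ bern) N +ℚ times-t (B q x) N             ≡⟨ cong ((B q x ⊛ bern) N +ℚ_) (sym (corr≡times-t q x N)) ⟩
  B (suc q) x N +ℚ corr q x N ∎

theorem4p4 : (p : ℕ) → 1 ≤ p → (n k : ℕ) → k ≤ n → (x : ℚ) →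
    sumTo (n ∸ k) (λ j → binom (n ∸ k) j *ℚ B p x (j + k))
      ≡ sumTo k (λ j → binom k j *ℚ (sgn j *ℚ (B p x (n ∸ j) +ℚ corr (p ∸ 1) x (n ∸ j))))
theorem4p4 (suc q) (s≤s z≤n) n k k≤n x = begin
  binomialSum (n ∸ k) (λ j → B (suc q) x (j + k))
    ≡⟨ binomialSum-shift-inversion (B (suc q) x) k (n ∸ k) ⟩
  binomialSum k (λ j → sgn j *ℚ binomialSum (n ∸ k + k ∸ j) (B (suc q) x))
    ≡⟨ sumTo-cong k (λ j _ → cong (λ s → binom k j *ℚ (sgn j *ℚ s)) (binomialSum-at j)) ⟩
  binomialSum k (λ j → sgn j *ℚ (B (suc q) x (n ∸ j) +ℚ corr q x (n ∸ j))) ∎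
  where
  binomialSum-at : ∀ j → binomialSum (n ∸ k + k ∸ j) (B (suc q) x) ≡ B (suc q) x (n ∸ j) +ℚ corr q x (n ∸ j)
  binomialSum-at j = trans (cong (λ N → binomialSum (N ∸ j) (B (suc q) x)) (m∸n+n≡m k≤n)) (binomialSum-B q x (n ∸ j))
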